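{- Let $K$ be a real number field of degree $d$ over $\mathbb{Q}$, and suppose $\beta_1,\dots,\beta_d\in\mathfrak{O}_K^+$ form a basis of $\mathfrak{O}_K$ as a $\mathbb{Z}$-module. Then $\mathrm{Frob}(\beta_1,\dots,\beta_d)=\mathrm{SG}(\beta_1,\dots,\beta_d)$.
   Context: A real number field is a number field that is a subfield of $\mathbb{R}$; $\mathfrak{O}_K$ is its ring of integers and $\mathfrak{O}_K^+=\mathfrak{O}_K\cap[0,\infty)$. $\mathbb{N}=\{0,1,2,\dots\}$. For $\alpha_1,\dots,\alpha_n\in\mathfrak{O}_K^+$: $\mathrm{SG}(\alpha_1,\dots,\alpha_n)=\{\sum x_i\alpha_i\mid x_i\in\mathbb{N}\}$; $C_\mathbb{Q}(\alpha_1,\dots,\alpha_n)=\{\sum x_i\alpha_i\mid x_i\in\mathbb{Q}_{\geqslant0}\}$; $\mathrm{Frob}(\alpha_1,\dots,\alpha_n)=\{w\in\mathrm{SG}(\alpha_1,\dots,\alpha_n)\mid w+(C_\mathbb{Q}(\alpha_1,\dots,\alpha_n)\cap\mathfrak{O}_K)\subseteq \mathrm{SG}(\alpha_1,\dots,\alpha_n)\}$. -}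

module Defs where

open import Level using (0ℓ)
open import Data.Nat as ℕ using (ℕ; zero; suc)
open import Data.Integer as ℤ using (ℤ; +_; -[1+_])
open import Data.Rational as ℚ using (ℚ; ↥_; ↧ₙ_)
open import Data.Fin using (Fin; toℕ)
import Data.Fin as Fin
open import Data.Product using (Σ; ∃; _×_; _,_)
open import Relation.Binary.PropositionalEquality using (_≡_; _≢_)
open import Relation.Nullary using (¬_)
open import Data.Sum using (_⊎_)

-- A real number field, presented abstractly: a field (equality is
-- propositional equality on the carrier) equipped with a total ordering
-- compatible with the field operations ("ordered field").  A number field
-- with an ordering embeds uniquely and order-preservingly into ℝ, so this
-- is the same as a subfield of ℝ (finite-dimensionality over ℚ is imposed
-- separately by `HasDegree`).

record OrderedField : Set₁ where
  infixl 6 _+_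
  infixl 7 _*_
  infix  4 _≤_
  field
    Carrier : Set
    0# 1#   : Carrier
    _+_ _*_ : Carrier → Carrier → Carrier
    -_      : Carrier → Carrier
    _⁻¹     : Carrier → Carrier           -- total inverse; 0 ⁻¹ is unconstrained
    _≤_     : Carrier → Carrier → Set
    +-assoc    : ∀ x y z → (x + y) + z ≡ x + (y + z)
    +-comm     : ∀ x y → x + y ≡ y + x
    +-identityˡ : ∀ x → 0# + x ≡ x
    -‿inverseˡ : ∀ x → (- x) + x ≡ 0#
    *-assoc    : ∀ x y z → (x * y) * z ≡ x * (y * z)
    *-comm     : ∀ x y → x * y ≡ y * x
    *-identityˡ : ∀ x → 1# * x ≡ x
    distribˡ   : ∀ x y z → x * (y + z) ≡ (x * y) + (x * z)
    0≢1        : 0# ≢ 1#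
    ⁻¹-inverseˡ : ∀ x → x ≢ 0# → (x ⁻¹) * x ≡ 1#
    ≤-refl     : ∀ x → x ≤ x
    ≤-trans    : ∀ {x y z} → x ≤ y → y ≤ z → x ≤ z
    ≤-antisym  : ∀ {x y} → x ≤ y → y ≤ x → x ≡ y
    ≤-total    : ∀ x y → x ≤ y ⊎ y ≤ x
    +-mono-≤   : ∀ {x y} z → x ≤ y → x + z ≤ y + z
    *-nonneg   : ∀ {x y} → 0# ≤ x → 0# ≤ y → 0# ≤ x * y

module _ (K : OrderedField) where
  open OrderedField K

  fromℕ : ℕ → Carrier
  fromℕ zero    = 0#
  fromℕ (suc n) = 1# + fromℕ n

  fromℤ : ℤ → Carrier
  fromℤ (+ n)     = fromℕ n
  fromℤ -[1+ n ]  = - fromℕ (suc n)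

  fromℚ : ℚ → Carrier
  fromℚ q = fromℤ (↥ q) * (fromℕ (↧ₙ q) ⁻¹)

  _^_ : Carrier → ℕ → Carrier
  x ^ zero  = 1#
  x ^ suc n = x * (x ^ n)

  ∑ : (n : ℕ) → (Fin n → Carrier) → Carrier
  ∑ zero    f = 0#
  ∑ (suc n) f = f Fin.zero + ∑ n (λ i → f (Fin.suc i))

  HasDegree : ℕ → Set
  HasDegree d = Σ (Fin d → Carrier) λ γ →
      (∀ x → ∃ λ (q : Fin d → ℚ) → x ≡ ∑ d (λ i → fromℚ (q i) * γ i))
    × (∀ (q : Fin d → ℚ) → ∑ d (λ i → fromℚ (q i) * γ i) ≡ 0# → ∀ i → q i ≡ ℚ.0ℚ)

  IsAlgInt : Carrier → Set
  IsAlgInt x = ∃ λ (n : ℕ) → ∃ λ (a : Fin n → ℤ) →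
      (x ^ n) + ∑ n (λ i → fromℤ (a i) * (x ^ toℕ i)) ≡ 0#

  IsAlgInt⁺ : Carrier → Set
  IsAlgInt⁺ x = IsAlgInt x × (0# ≤ x)

  IsIntegralBasis : (d : ℕ) → (Fin d → Carrier) → Set
  IsIntegralBasis d β =
      (∀ i → IsAlgInt (β i))
    × (∀ x → IsAlgInt x → ∃ λ (n : Fin d → ℤ) → x ≡ ∑ d (λ i → fromℤ (n i) * β i))
    × (∀ (n : Fin d → ℤ) → ∑ d (λ i → fromℤ (n i) * β i) ≡ 0# → ∀ i → n i ≡ + 0)

  InSG : (n : ℕ) → (Fin n → Carrier) → Carrier → Set
  InSG n α w = ∃ λ (x : Fin n → ℕ) → w ≡ ∑ n (λ i → fromℕ (x i) * α i)

  InConeℚ : (n : ℕ) → (Fin n → Carrier) → Carrier → Set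
  InConeℚ n α w = ∃ λ (x : Fin n → ℚ) → (∀ i → ℚ.0ℚ ℚ.≤ x i)
                                     × (w ≡ ∑ n (λ i → fromℚ (x i) * α i))

  InFrob : (n : ℕ) → (Fin n → Carrier) → Carrier → Set
  InFrob n α w = InSG n α w
               × (∀ z → InConeℚ n α z → IsAlgInt z → InSG n α (w + z))

{-# OPTIONS --safe #-}
module Submission where

-- Conversely, SG is closed under addition, so it
-- suffices that every z ∈ C_ℚ(β) ∩ 𝔒_K lies in SG. As β is an integral basis,
-- z = Σ nᵢ βᵢ with nᵢ ∈ ℤ; as z lies in the cone, z = Σ qᵢ βᵢ with qᵢ ∈ ℚ≥0.
-- Clearing a common denominator D gives D z = Σ mᵢ βᵢ with mᵢ ∈ ℕ, and
-- uniqueness of integral coordinates forces D nᵢ = mᵢ ≥ 0.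

open import Defs
open import Data.Fin using (Fin)
open import Function.Bundles using (_⇔_; mk⇔)

open import Level using (0ℓ)
open import Algebra.Bundles using (CommutativeRing)
open import Algebra.Consequences.Propositional
  using (comm∧idˡ⇒idʳ; comm∧invˡ⇒invʳ; comm∧distrˡ⇒distrʳ)
import Algebra.Properties.Ring as RingProperties
import Algebra.Properties.CommutativeSemigroup as CommutativeSemigroupProperties
open import Data.Nat as ℕ using (ℕ; zero; suc)
import Data.Nat.Properties as ℕ
open import Data.Integer as ℤ using (ℤ; +_; -[1+_]; _⊖_; ∣_∣; +≤+)
import Data.Integer.Properties as ℤ
open import Algebra.Properties.AbelianGroup ℤ.+-0-abelianGroup
  using () renaming (//-rightDividesˡ to ℤ//-rightDividesˡ)
open import Data.Rational as ℚ using (mkℚ; ↥_; ↧ₙ_; *≤*)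
import Data.Fin as Fin
open import Data.Product using (∃₂; _,_; proj₁)
open import Data.Sum using (inj₁; inj₂)
open import Function.Base using (_∘_)
open import Relation.Binary.PropositionalEquality
open import Relation.Nullary using (contradiction)

module OrderedFieldProperties (K : OrderedField) where
  open OrderedField K
  open ≡-Reasoning

  commutativeRing : CommutativeRing 0ℓ 0ℓ
  commutativeRing = record
    { isCommutativeRing = record
      { isRing = record
        { +-isAbelianGroup = record
          { isGroup = record
            { isMonoid = record
              { isSemigroup = record
                { isMagma = record { isEquivalence = isEquivalence ; ∙-cong = cong₂ _+_ }
                ; assoc = +-assoc }
              ; identity = +-identityˡ , comm∧idˡ⇒idʳ +-comm +-identityˡ }
            ; inverse = -‿inverseˡ , comm∧invˡ⇒invʳ +-comm -‿inverseˡ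
            ; ⁻¹-cong = cong -_ }
          ; comm = +-comm }
        ; *-cong = cong₂ _*_
        ; *-assoc = *-assoc
        ; *-identity = *-identityˡ , comm∧idˡ⇒idʳ *-comm *-identityˡ
        ; distrib = distribˡ , comm∧distrˡ⇒distrʳ *-comm distribˡ }
      ; *-comm = *-comm } }

  open CommutativeRing commutativeRing public using (distribʳ)
  open CommutativeRing commutativeRing
    using (_-_; +-identityʳ; *-identityʳ; -‿inverseʳ; zeroˡ; zeroʳ;
           ring; +-commutativeSemigroup; *-commutativeSemigroup)
  open RingProperties ring public using (+-identityˡ-unique)
  open RingProperties ring using (-0#≈0#; -‿involutive; -‿+-comm; -1*x≈-x)
  open CommutativeSemigroupProperties +-commutativeSemigroup using (interchange)
  open CommutativeSemigroupProperties *-commutativeSemigroup using (x∙yz≈y∙xz)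

  0≤1 : 0# ≤ 1#
  0≤1 with ≤-total 0# 1#
  ... | inj₁ 0≤1 = 0≤1
  ... | inj₂ 1≤0 = contradiction (≤-antisym 0≤[-1]² 1≤0) 0≢1
    where
    0≤-1 : 0# ≤ - 1#
    0≤-1 = subst₂ _≤_ (-‿inverseʳ 1#) (+-identityˡ (- 1#)) (+-mono-≤ (- 1#) 1≤0)
    0≤[-1]² : 0# ≤ 1#
    0≤[-1]² = subst (0# ≤_) (trans (-1*x≈-x (- 1#)) (-‿involutive 1#)) (*-nonneg 0≤-1 0≤-1)

  1≤1+x : ∀ {x} → 0# ≤ x → 1# ≤ 1# + x
  1≤1+x {x} 0≤x = subst₂ _≤_ (+-identityˡ 1#) (+-comm x 1#) (+-mono-≤ 1# 0≤x)

  fromℕ-nonneg : ∀ n → 0# ≤ fromℕ K n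
  fromℕ-nonneg zero    = ≤-refl 0#
  fromℕ-nonneg (suc n) = ≤-trans 0≤1 (1≤1+x (fromℕ-nonneg n))

  fromℕ-suc≢0 : ∀ n → fromℕ K (suc n) ≢ 0#
  fromℕ-suc≢0 n eq = 0≢1 (≤-antisym 0≤1 (subst (1# ≤_) eq (1≤1+x (fromℕ-nonneg n))))

  fromℕ-+ : ∀ m n → fromℕ K (m ℕ.+ n) ≡ fromℕ K m + fromℕ K n
  fromℕ-+ zero    n = sym (+-identityˡ (fromℕ K n))
  fromℕ-+ (suc m) n = trans (cong (_+_ 1#) (fromℕ-+ m n)) (sym (+-assoc 1# _ _))

  fromℕ-* : ∀ m n → fromℕ K (m ℕ.* n) ≡ fromℕ K m * fromℕ K n
  fromℕ-* zero    n = sym (zeroˡ (fromℕ K n))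
  fromℕ-* (suc m) n = begin
    fromℕ K (n ℕ.+ m ℕ.* n)                ≡⟨ fromℕ-+ n (m ℕ.* n) ⟩
    fromℕ K n + fromℕ K (m ℕ.* n)          ≡⟨ cong₂ _+_ (sym (*-identityˡ _)) (fromℕ-* m n) ⟩
    1# * fromℕ K n + fromℕ K m * fromℕ K n ≡⟨ distribʳ (fromℕ K n) 1# (fromℕ K m) ⟨
    (1# + fromℕ K m) * fromℕ K n           ∎

  fromℕ-*-assoc : ∀ m n x → fromℕ K (m ℕ.* n) * x ≡ fromℕ K m * (fromℕ K n * x)
  fromℕ-*-assoc m n x = trans (cong (_* x) (fromℕ-* m n)) (*-assoc _ _ x)

  fromℤ-⊖ : ∀ m n → fromℤ K (m ⊖ n) ≡ fromℕ K m - fromℕ K n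
  fromℤ-⊖ m       zero    = sym (trans (cong (_+_ (fromℕ K m)) -0#≈0#) (+-identityʳ _))
  fromℤ-⊖ zero    (suc n) = sym (+-identityˡ _)
  fromℤ-⊖ (suc m) (suc n) = begin
    fromℤ K (suc m ⊖ suc n)                 ≡⟨ cong (fromℤ K) (ℤ.[1+m]⊖[1+n]≡m⊖n m n) ⟩
    fromℤ K (m ⊖ n)                         ≡⟨ fromℤ-⊖ m n ⟩
    fromℕ K m - fromℕ K n                   ≡⟨ +-identityˡ _ ⟨
    0# + (fromℕ K m - fromℕ K n)            ≡⟨ cong (_+ (fromℕ K m - fromℕ K n)) (-‿inverseʳ 1#) ⟨
    (1# - 1#) + (fromℕ K m - fromℕ K n)     ≡⟨ interchange 1# (- 1#) (fromℕ K m) (- fromℕ K n) ⟩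
    (1# + fromℕ K m) + (- 1# - fromℕ K n)   ≡⟨ cong (_+_ (1# + fromℕ K m)) (-‿+-comm 1# (fromℕ K n)) ⟩
    (1# + fromℕ K m) - (1# + fromℕ K n)     ∎

  fromℤ-+ : ∀ i j → fromℤ K (i ℤ.+ j) ≡ fromℤ K i + fromℤ K j
  fromℤ-+ (+ m)    (+ n)    = fromℕ-+ m n
  fromℤ-+ (+ m)    -[1+ n ] = fromℤ-⊖ m (suc n)
  fromℤ-+ -[1+ m ] (+ n)    = trans (fromℤ-⊖ n (suc m)) (+-comm _ _)
  fromℤ-+ -[1+ m ] -[1+ n ] = begin
    - fromℕ K (suc (suc (m ℕ.+ n)))          ≡⟨ cong (-_ ∘ fromℕ K) (ℕ.+-suc (suc m) n) ⟨
    - fromℕ K (suc m ℕ.+ suc n)              ≡⟨ cong -_ (fromℕ-+ (suc m) (suc n)) ⟩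
    - (fromℕ K (suc m) + fromℕ K (suc n))    ≡⟨ -‿+-comm _ _ ⟨
    - fromℕ K (suc m) - fromℕ K (suc n)      ∎

  fromℤ-+* : ∀ c i → fromℤ K (+ c ℤ.* i) ≡ fromℕ K c * fromℤ K i
  fromℤ-+* zero    i = sym (zeroˡ (fromℤ K i))
  fromℤ-+* (suc c) i = begin
    fromℤ K (+ suc c ℤ.* i)                 ≡⟨ cong (fromℤ K) (ℤ.suc-* (+ c) i) ⟩
    fromℤ K (i ℤ.+ + c ℤ.* i)               ≡⟨ fromℤ-+ i (+ c ℤ.* i) ⟩
    fromℤ K i + fromℤ K (+ c ℤ.* i)         ≡⟨ cong₂ _+_ (sym (*-identityˡ _)) (fromℤ-+* c i) ⟩
    1# * fromℤ K i + fromℕ K c * fromℤ K i  ≡⟨ distribʳ (fromℤ K i) 1# (fromℕ K c) ⟨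
    (1# + fromℕ K c) * fromℤ K i            ∎

  fromℚ-nonneg : ∀ q → ℚ.0ℚ ℚ.≤ q → fromℚ K q ≡ fromℕ K ∣ ↥ q ∣ * fromℕ K (↧ₙ q) ⁻¹
  fromℚ-nonneg (mkℚ (+ n) _ _) _ = refl
  fromℚ-nonneg (mkℚ -[1+ n ] _ _) (*≤* ())

  ↧ₙ*fromℚ : ∀ q → ℚ.0ℚ ℚ.≤ q → fromℕ K (↧ₙ q) * fromℚ K q ≡ fromℕ K ∣ ↥ q ∣
  ↧ₙ*fromℚ q 0≤q = begin
    b * fromℚ K q    ≡⟨ cong (b *_) (fromℚ-nonneg q 0≤q) ⟩
    b * (a * b ⁻¹)   ≡⟨ x∙yz≈y∙xz b a (b ⁻¹) ⟩
    a * (b * b ⁻¹)   ≡⟨ cong (a *_) (trans (*-comm b (b ⁻¹)) (⁻¹-inverseˡ b (fromℕ-suc≢0 (ℚ.ℚ.denominator-1 q)))) ⟩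
    a * 1#           ≡⟨ *-identityʳ a ⟩
    a                ∎
    where
    a = fromℕ K ∣ ↥ q ∣
    b = fromℕ K (↧ₙ q)

  common-denominator : ∀ n (x : Fin n → Carrier) →
    (∀ i → ∃₂ λ D m → fromℕ K (suc D) * x i ≡ fromℕ K m) →
    ∃₂ λ D (m : Fin n → ℕ) → ∀ i → fromℕ K (suc D) * x i ≡ fromℕ K (m i)
  common-denominator zero    x _  = 0 , (λ ()) , (λ ())
  common-denominator (suc n) x hx
    with D₀ , m₀ , h₀ ← hx Fin.zero
       | D , m , h ← common-denominator n (x ∘ Fin.suc) (hx ∘ Fin.suc)
    -- suc (D₀ + D * suc D₀) reduces to suc D * suc D₀
    = D₀ ℕ.+ D ℕ.* suc D₀ , m′ , h′
    where
    m′ : Fin (suc n) → ℕ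
    m′ Fin.zero    = suc D ℕ.* m₀
    m′ (Fin.suc i) = suc D₀ ℕ.* m i
    h′ : ∀ i → fromℕ K (suc D ℕ.* suc D₀) * x i ≡ fromℕ K (m′ i)
    h′ Fin.zero = begin
      fromℕ K (suc D ℕ.* suc D₀) * x Fin.zero          ≡⟨ fromℕ-*-assoc (suc D) (suc D₀) _ ⟩
      fromℕ K (suc D) * (fromℕ K (suc D₀) * x Fin.zero) ≡⟨ cong (fromℕ K (suc D) *_) h₀ ⟩
      fromℕ K (suc D) * fromℕ K m₀                      ≡⟨ fromℕ-* (suc D) m₀ ⟨
      fromℕ K (suc D ℕ.* m₀)                            ∎
    h′ (Fin.suc i) = begin
      fromℕ K (suc D ℕ.* suc D₀) * x (Fin.suc i)          ≡⟨ cong (λ k → fromℕ K k * x (Fin.suc i)) (ℕ.*-comm (suc D) (suc D₀)) ⟩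
      fromℕ K (suc D₀ ℕ.* suc D) * x (Fin.suc i)          ≡⟨ fromℕ-*-assoc (suc D₀) (suc D) _ ⟩
      fromℕ K (suc D₀) * (fromℕ K (suc D) * x (Fin.suc i)) ≡⟨ cong (fromℕ K (suc D₀) *_) (h i) ⟩
      fromℕ K (suc D₀) * fromℕ K (m i)                     ≡⟨ fromℕ-* (suc D₀) (m i) ⟨
      fromℕ K (suc D₀ ℕ.* m i)                             ∎

  ∑-cong : ∀ n {f g : Fin n → Carrier} → (∀ i → f i ≡ g i) → ∑ K n f ≡ ∑ K n g
  ∑-cong zero    f≗g = refl
  ∑-cong (suc n) f≗g = cong₂ _+_ (f≗g Fin.zero) (∑-cong n (f≗g ∘ Fin.suc))

  ∑-distrib-+ : ∀ n (f g : Fin n → Carrier) → ∑ K n (λ i → f i + g i) ≡ ∑ K n f + ∑ K n g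
  ∑-distrib-+ zero    f g = sym (+-identityˡ 0#)
  ∑-distrib-+ (suc n) f g = trans
    (cong (_+_ (f Fin.zero + g Fin.zero)) (∑-distrib-+ n (f ∘ Fin.suc) (g ∘ Fin.suc)))
    (interchange (f Fin.zero) (g Fin.zero) _ _)

  *-distribˡ-∑ : ∀ n c (f : Fin n → Carrier) → c * ∑ K n f ≡ ∑ K n (λ i → c * f i)
  *-distribˡ-∑ zero    c f = zeroʳ c
  *-distribˡ-∑ (suc n) c f = trans (distribˡ c _ _)
    (cong (_+_ (c * f Fin.zero)) (*-distribˡ-∑ n c (f ∘ Fin.suc)))

module IntegralCoordinates (K : OrderedField) {d : ℕ} (β : Fin d → OrderedField.Carrier K) where
  open OrderedField K
  open OrderedFieldProperties K
  open ≡-Reasoning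

  ℤ-combination : (Fin d → ℤ) → Carrier
  ℤ-combination n = ∑ K d (λ i → fromℤ K (n i) * β i)

  ℤ-Independent : Set
  ℤ-Independent = ∀ n → ℤ-combination n ≡ 0# → ∀ i → n i ≡ + 0

  ℤ-combination-cong : ∀ {a b} → (∀ i → a i ≡ b i) → ℤ-combination a ≡ ℤ-combination b
  ℤ-combination-cong a≗b = ∑-cong d (λ i → cong (λ k → fromℤ K k * β i) (a≗b i))

  ℤ-combination-+ : ∀ a b → ℤ-combination (λ i → a i ℤ.+ b i) ≡ ℤ-combination a + ℤ-combination b
  ℤ-combination-+ a b = trans
    (∑-cong d (λ i → trans (cong (_* β i) (fromℤ-+ (a i) (b i))) (distribʳ (β i) _ _)))
    (∑-distrib-+ d _ _)

  fromℕ*ℤ-combination : ∀ c n → fromℕ K c * ℤ-combination n ≡ ℤ-combination (λ i → + c ℤ.* n i)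
  fromℕ*ℤ-combination c n = trans (*-distribˡ-∑ d _ _)
    (∑-cong d (λ i → trans (sym (*-assoc _ _ _)) (cong (_* β i) (sym (fromℤ-+* c (n i))))))

  ℤ-combination-injective : ℤ-Independent →
    ∀ a b → ℤ-combination a ≡ ℤ-combination b → ∀ i → a i ≡ b i
  ℤ-combination-injective indep a b a≡b i =
    ℤ.i-j≡0⇒i≡j (a i) (b i) (indep (λ i → a i ℤ.- b i) difference≡0 i)
    where
    difference≡0 : ℤ-combination (λ i → a i ℤ.- b i) ≡ 0#
    difference≡0 = +-identityˡ-unique _ (ℤ-combination b) (begin
      ℤ-combination (λ i → a i ℤ.- b i) + ℤ-combination b ≡⟨ ℤ-combination-+ (λ i → a i ℤ.- b i) b ⟨
      ℤ-combination (λ i → a i ℤ.- b i ℤ.+ b i)           ≡⟨ ℤ-combination-cong (λ i → ℤ//-rightDividesˡ (b i) (a i)) ⟩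
      ℤ-combination a                                     ≡⟨ a≡b ⟩
      ℤ-combination b                                     ∎)

  InSG-+ : ∀ {w z} → InSG K d β w → InSG K d β z → InSG K d β (w + z)
  InSG-+ (x , w≡) (y , z≡) =
    (λ i → x i ℕ.+ y i) , trans (cong₂ _+_ w≡ z≡) (sym (ℤ-combination-+ (λ i → + x i) (λ i → + y i)))

  +[1+m]*i≡+n⇒0≤i : ∀ m n i → + suc m ℤ.* i ≡ + n → ℤ.0ℤ ℤ.≤ i
  +[1+m]*i≡+n⇒0≤i m n (+ k)    _  = +≤+ ℕ.z≤n
  +[1+m]*i≡+n⇒0≤i m n -[1+ k ] ()

  cone-coordinates-nonneg : ℤ-Independent →
    ∀ n → InConeℚ K d β (ℤ-combination n) → ∀ i → ℤ.0ℤ ℤ.≤ n i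
  cone-coordinates-nonneg indep n (q , 0≤q , n≡q) i
    with D , m , Dq≡m ← common-denominator d (fromℚ K ∘ q)
                          (λ i → ℚ.ℚ.denominator-1 (q i) , ∣ ↥ q i ∣ , ↧ₙ*fromℚ (q i) (0≤q i))
    = +[1+m]*i≡+n⇒0≤i D (m i) (n i)
        (ℤ-combination-injective indep (λ i → + suc D ℤ.* n i) (λ i → + m i) Dn≡m i)
    where
    Dn≡m : ℤ-combination (λ i → + suc D ℤ.* n i) ≡ ℤ-combination (λ i → + m i)
    Dn≡m = begin
      ℤ-combination (λ i → + suc D ℤ.* n i)                    ≡⟨ fromℕ*ℤ-combination (suc D) n ⟨
      fromℕ K (suc D) * ℤ-combination n                        ≡⟨ cong (fromℕ K (suc D) *_) n≡q ⟩
      fromℕ K (suc D) * ∑ K d (λ i → fromℚ K (q i) * β i)      ≡⟨ *-distribˡ-∑ d _ _ ⟩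
      ∑ K d (λ i → fromℕ K (suc D) * (fromℚ K (q i) * β i))    ≡⟨ ∑-cong d (λ i → trans (sym (*-assoc _ _ _)) (cong (_* β i) (Dq≡m i))) ⟩
      ℤ-combination (λ i → + m i)                              ∎

  integral-cone⊆SG : ℤ-Independent →
    ∀ n → InConeℚ K d β (ℤ-combination n) → InSG K d β (ℤ-combination n)
  integral-cone⊆SG indep n n∈C = (λ i → ∣ n i ∣) ,
    ℤ-combination-cong (λ i → sym (ℤ.0≤i⇒+∣i∣≡i (cone-coordinates-nonneg indep n n∈C i)))

lemma5 : (K : OrderedField) (d : ℕ) → HasDegree K d →
         (β : Fin d → OrderedField.Carrier K) →
         (∀ i → IsAlgInt⁺ K (β i)) →
         IsIntegralBasis K d β →
         ∀ w → InFrob K d β w ⇔ InSG K d β w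
lemma5 K d _ β _ (_ , span , indep) w = mk⇔ proj₁ (λ w∈SG → w∈SG , translate w∈SG)
  where
  open OrderedField K using (_+_)
  open IntegralCoordinates K β
  translate : InSG K d β w → ∀ z → InConeℚ K d β z → IsAlgInt K z → InSG K d β (w + z)
  translate w∈SG z z∈C z∈𝔒 with n , refl ← span z z∈𝔒 = InSG-+ w∈SG (integral-cone⊆SG indep n z∈C)
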